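{- Let $f,g,x,y,z$ be complex numbers with $x\neq0$, $y\neq0$, let $k,r,s$ be integers and $n$ a nonnegative integer, and suppose that for every $i\in\{0,\dots,n\}$ the quantity $D_i:=(xy)^{rn} z^2 - (xy)^{ri} (x^{r(n - 2i)} + y^{r(n - 2i)} )z + 1$ is nonzero. Then \[ \begin{split} &2\sum_{j = 0}^k (fx^{rj + s} + gy^{rj + s} )^n z^j \\ &=z^{k + 2}\sum_{i = 0}^n (fg)^i(xy)^{si}\binom ni\frac{f^{n - 2i} x^{s(n - 2i) + rn(k + 1) - rik} y^{r(ik + n)} + g^{n - 2i} x^{r(ik + n)} y^{s(n - 2i) + rn(k + 1) - rik} }{D_i} \\ &\quad-z^{k + 1}\sum_{i = 0}^n (fg)^i(xy)^{si}\binom ni\frac{f^{n - 2i} x^{s(n - 2i) + (rn - ri)(k + 1)} y^{ri(k + 1)} + g^{n - 2i} x^{ri(k + 1)} y^{s(n - 2i) + (rn - ri)(k + 1)} }{D_i} \\ &\quad-z\sum_{i = 0}^n (fg)^i(xy)^{si}\binom ni\frac{f^{n - 2i} x^{s(n - 2i) + ri} y^{r(n - i)} + g^{n - 2i} x^{r(n - i)} y^{s(n - 2i) + ri} }{D_i} \\ &\quad+\sum_{i = 0}^n (fg)^i(xy)^{si}\binom ni\frac{f^{n - 2i} x^{s(n - 2i)} + g^{n - 2i} y^{s(n - 2i)} }{D_i}\,, \end{split} \] where the products $(fg)^i f^{n-2i}$ and $(fg)^i g^{n-2i}$ are understood as $f^{n-i}g^i$ and $f^i g^{n-i}$ respectively.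 -}

module Defs where

open import Level using (_⊔_)
open import Data.Nat as ℕ using (ℕ; zero; suc)
open import Data.Integer as ℤ using (ℤ; +_; -[1+_])
open import Relation.Nullary using (¬_)
open import Algebra.Bundles using (CommutativeRing)

-- A field, presented (as in Mathlib) as a commutative ring with 1 ≠ 0 and a
-- total inverse operation _⁻¹ (congruent w.r.t. ≈) such that x * x⁻¹ ≈ 1
-- for every x ≉ 0.  (The value of 0⁻¹ is irrelevant/unspecified.)
record Field (c ℓ : Level.Level) : Set (Level.suc (c ⊔ ℓ)) where
  field
    commutativeRing : CommutativeRing c ℓ
  open CommutativeRing commutativeRing public
  field
    _⁻¹      : Carrier → Carrier
    ⁻¹-cong  : ∀ {a b} → a ≈ b → a ⁻¹ ≈ b ⁻¹
    1≉0      : ¬ (1# ≈ 0#)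
    inverseʳ : ∀ a → ¬ (a ≈ 0#) → a * (a ⁻¹) ≈ 1#

  infixl 7 _/_
  _/_ : Carrier → Carrier → Carrier
  a / b = a * (b ⁻¹)

  infixr 8 _^_
  _^_ : Carrier → ℕ → Carrier
  a ^ zero  = 1#
  a ^ suc m = a * (a ^ m)

  infixr 8 _^ᶻ_
  _^ᶻ_ : Carrier → ℤ → Carrier
  a ^ᶻ (+ m)     = a ^ m
  a ^ᶻ -[1+ m ]  = (a ^ suc m) ⁻¹

  fromℕ : ℕ → Carrier
  fromℕ zero    = 0#
  fromℕ (suc m) = 1# + fromℕ m

  sum0to : ℕ → (ℕ → Carrier) → Carrier
  sum0to zero    h = h 0
  sum0to (suc m) h = sum0to m h + h (suc m)

  -- Σ_{j=0}^{k} h j for an integer upper limit k, with the standard convention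
  --   Σ_{j=0}^{-1} h j = 0  and  Σ_{j=0}^{k} h j = - Σ_{j=k+1}^{-1} h j  for k ≤ -2,
  -- i.e. Σ_{j=0}^{k} h j - Σ_{j=0}^{k-1} h j = h k for every integer k.
  sumUpTo : ℤ → (ℤ → Carrier) → Carrier
  sumUpTo (+ m)    h = sum0to m (λ j → h (+ j))
  sumUpTo -[1+ m ] h = - negPart m
    where
    negPart : ℕ → Carrier
    negPart zero    = 0#
    negPart (suc u) = negPart u + h -[1+ u ]

-- Expanding (f x^(rj+s) + g y^(rj+s))^n binomially, the i-th term is
-- C(n,i) f^i g^(n-i) x^(si) y^(s(n-i)) (ρ_i z)^j with ρ_i = x^(ri) y^(r(n-i)), so after exchanging
-- the sums each i contributes a geometric series in ρ_i z, which telescopes to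
-- (1 - (ρ_i z)^(k+1)) / (1 - ρ_i z).  Since D_i = (1 - ρ_i z)(1 - ρ_(n-i) z), multiplying by
-- 1 - ρ_(n-i) z puts every term over D_i, and expanding the numerator yields the four sums, but
-- only with the f^i g^(n-i) half of each bracket.  Exchanging (f, x) with (g, y) leaves the
-- left-hand side unchanged and yields the other half, so the sum of both expansions is twice it.
module Submission where

open import Defs
open import Level using (Level)
open import Data.Nat as ℕ using (ℕ; zero; suc; _∸_)
open import Data.Nat.Combinatorics using (_C_)
open import Data.Integer as ℤ using (ℤ; +_; -[1+_]; _⊖_)
import Data.Integer.Properties as ℤP
import Data.Nat.Properties as ℕP
open import Data.Maybe using (Maybe; just; nothing)
open import Relation.Binary.PropositionalEquality as ≡ using (_≡_)
open import Relation.Nullary using (¬_; yes; no; contradiction)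
open import Algebra.Bundles using (CommutativeRing)
import Data.Integer.Tactic.RingSolver as ℤSolver
import Algebra.Solver.Ring
import Algebra.Solver.Ring.AlmostCommutativeRing as ACR

module IntegerCoefficients {c ℓ} (R : CommutativeRing c ℓ) where
  open CommutativeRing R
  open import Algebra.Properties.Semiring.Mult.TCOptimised semiring using (_×_; ×-homo-+)
  open import Algebra.Properties.Ring ring using (-‿distribˡ-*)
  open import Algebra.Properties.AbelianGroup +-abelianGroup using (⁻¹-∙-comm; ε⁻¹≈ε; ⁻¹-involutive)
  open import Algebra.Properties.CommutativeSemigroup +-commutativeSemigroup using (interchange)
  open import Relation.Binary.Reasoning.Setoid setoid

  -- With the type-checking optimised multiple, 1 × 1# is 1# on the nose, as the solver's proofs by refl need.
  fromℤ : ℤ → Carrier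
  fromℤ (+ n)    = n × 1#
  fromℤ -[1+ n ] = - (suc n × 1#)

  suc×1 : ∀ n → suc n × 1# ≈ 1# + n × 1#
  suc×1 n = ×-homo-+ 1# 1 n

  fromℤ-⊖ : ∀ m n → fromℤ (m ⊖ n) ≈ m × 1# - n × 1#
  fromℤ-⊖ zero    zero    = sym (-‿inverseʳ 0#)
  fromℤ-⊖ zero    (suc n) = sym (+-identityˡ _)
  fromℤ-⊖ (suc m) zero    = sym (trans (+-congˡ ε⁻¹≈ε) (+-identityʳ _))
  fromℤ-⊖ (suc m) (suc n) = begin
    fromℤ (suc m ⊖ suc n)           ≡⟨ ≡.cong fromℤ (ℤP.[1+m]⊖[1+n]≡m⊖n m n) ⟩
    fromℤ (m ⊖ n)                   ≈⟨ fromℤ-⊖ m n ⟩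
    m × 1# - n × 1#                 ≈⟨ +-identityˡ _ ⟨
    0# + (m × 1# - n × 1#)          ≈⟨ +-congʳ (-‿inverseʳ 1#) ⟨
    (1# - 1#) + (m × 1# - n × 1#)   ≈⟨ interchange _ _ _ _ ⟩
    (1# + m × 1#) + (- 1# - n × 1#) ≈⟨ +-cong (suc×1 m) (trans (-‿cong (suc×1 n)) (sym (⁻¹-∙-comm _ _))) ⟨
    suc m × 1# - suc n × 1#         ∎

  fromℤ-+ : ∀ i j → fromℤ (i ℤ.+ j) ≈ fromℤ i + fromℤ j
  fromℤ-+ (+ m)    (+ n)    = ×-homo-+ 1# m n
  fromℤ-+ (+ m)    -[1+ n ] = fromℤ-⊖ m (suc n)
  fromℤ-+ -[1+ m ] (+ n)    = trans (fromℤ-⊖ n (suc m)) (+-comm _ _)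
  fromℤ-+ -[1+ m ] -[1+ n ] = begin
    - (suc (suc (m ℕ.+ n)) × 1#)    ≡⟨ ≡.cong (λ t → - (suc t × 1#)) (ℕP.+-suc m n) ⟨
    - ((suc m ℕ.+ suc n) × 1#)      ≈⟨ -‿cong (×-homo-+ 1# (suc m) (suc n)) ⟩
    - (suc m × 1# + suc n × 1#)     ≈⟨ ⁻¹-∙-comm _ _ ⟨
    - (suc m × 1#) - suc n × 1#     ∎

  fromℤ-neg : ∀ i → fromℤ (ℤ.- i) ≈ - fromℤ i
  fromℤ-neg (+ zero)  = sym ε⁻¹≈ε
  fromℤ-neg (+ suc n) = refl
  fromℤ-neg -[1+ n ]  = sym (⁻¹-involutive _)

  fromℤ-*ⁿ : ∀ m j → fromℤ (+ m ℤ.* j) ≈ m × 1# * fromℤ j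
  fromℤ-*ⁿ zero    j = trans (reflexive (≡.cong fromℤ (ℤP.*-zeroˡ j))) (sym (zeroˡ _))
  fromℤ-*ⁿ (suc m) j = begin
    fromℤ (+ suc m ℤ.* j)              ≡⟨ ≡.cong fromℤ (ℤP.suc-* (+ m) j) ⟩
    fromℤ (j ℤ.+ + m ℤ.* j)            ≈⟨ fromℤ-+ j (+ m ℤ.* j) ⟩
    fromℤ j + fromℤ (+ m ℤ.* j)        ≈⟨ +-cong (sym (*-identityˡ _)) (fromℤ-*ⁿ m j) ⟩
    1# * fromℤ j + m × 1# * fromℤ j    ≈⟨ distribʳ _ _ _ ⟨
    (1# + m × 1#) * fromℤ j            ≈⟨ *-congʳ (suc×1 m) ⟨
    suc m × 1# * fromℤ j               ∎

  fromℤ-* : ∀ i j → fromℤ (i ℤ.* j) ≈ fromℤ i * fromℤ j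
  fromℤ-* (+ m)    j = fromℤ-*ⁿ m j
  fromℤ-* -[1+ m ] j = begin
    fromℤ (-[1+ m ] ℤ.* j)             ≡⟨ ≡.cong fromℤ (ℤP.neg-distribˡ-* (+ suc m) j) ⟨
    fromℤ (ℤ.- (+ suc m ℤ.* j))        ≈⟨ fromℤ-neg (+ suc m ℤ.* j) ⟩
    - fromℤ (+ suc m ℤ.* j)            ≈⟨ -‿cong (fromℤ-*ⁿ (suc m) j) ⟩
    - (suc m × 1# * fromℤ j)           ≈⟨ -‿distribˡ-* _ _ ⟩
    - (suc m × 1#) * fromℤ j           ∎

  fromℤ-homomorphism : ℤ.+-*-rawRing ACR.-Raw-AlmostCommutative⟶ ACR.fromCommutativeRing R
  fromℤ-homomorphism = record
    { ⟦_⟧ = fromℤ ; +-homo = fromℤ-+ ; *-homo = fromℤ-* ; -‿homo = fromℤ-neg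
    ; 0-homo = refl ; 1-homo = refl }

  fromℤ-≟ : ∀ i j → Maybe (fromℤ i ≈ fromℤ j)
  fromℤ-≟ i j with i ℤ.≟ j
  ... | yes i≡j = just (reflexive (≡.cong fromℤ i≡j))
  ... | no  _   = nothing

  open Algebra.Solver.Ring ℤ.+-*-rawRing (ACR.fromCommutativeRing R) fromℤ-homomorphism fromℤ-≟ public
    using (solve; _:=_; _:+_; _:*_; _:-_; :-_; con)

module FieldProperties {c ℓ} (F : Field c ℓ) where
  open Field F hiding (zero)
  open IntegerCoefficients commutativeRing
  import Algebra.Properties.Semiring.Exp semiring as Exp
  import Algebra.Properties.CommutativeSemiring.Exp commutativeSemiring as CExp
  open import Algebra.Properties.CommutativeSemigroup *-commutativeSemigroup using (interchange)
  open import Algebra.Properties.CommutativeSemigroup +-commutativeSemigroup using () renaming (interchange to +-interchange)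
  open import Algebra.Properties.AbelianGroup +-abelianGroup using (⁻¹-∙-comm) renaming (ε⁻¹≈ε to -0#≈0#)
  open import Relation.Binary.Reasoning.Setoid setoid

  *-≉0 : ∀ {a b} → ¬ a ≈ 0# → ¬ b ≈ 0# → ¬ a * b ≈ 0#
  *-≉0 {a} {b} a≉0 b≉0 ab≈0 = a≉0 (begin
    a                ≈⟨ *-identityʳ a ⟨
    a * 1#           ≈⟨ *-congˡ (inverseʳ b b≉0) ⟨
    a * (b * b ⁻¹)   ≈⟨ *-assoc a b (b ⁻¹) ⟨
    a * b * b ⁻¹     ≈⟨ *-congʳ ab≈0 ⟩
    0# * b ⁻¹        ≈⟨ zeroˡ _ ⟩
    0#               ∎)

  ⁻¹-unique : ∀ {a b} → ¬ a ≈ 0# → a * b ≈ 1# → b ≈ a ⁻¹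
  ⁻¹-unique {a} {b} a≉0 ab≈1 = begin
    b                ≈⟨ *-identityʳ b ⟨
    b * 1#           ≈⟨ *-congˡ (inverseʳ a a≉0) ⟨
    b * (a * a ⁻¹)   ≈⟨ *-assoc b a (a ⁻¹) ⟨
    b * a * a ⁻¹     ≈⟨ *-congʳ (trans (*-comm b a) ab≈1) ⟩
    1# * a ⁻¹        ≈⟨ *-identityˡ _ ⟩
    a ⁻¹             ∎

  1⁻¹≈1 : 1# ⁻¹ ≈ 1#
  1⁻¹≈1 = sym (⁻¹-unique 1≉0 (*-identityˡ 1#))

  ⁻¹-distrib-* : ∀ {a b} → ¬ a ≈ 0# → ¬ b ≈ 0# → (a * b) ⁻¹ ≈ a ⁻¹ * b ⁻¹
  ⁻¹-distrib-* {a} {b} a≉0 b≉0 = sym (⁻¹-unique (*-≉0 a≉0 b≉0) (begin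
    a * b * (a ⁻¹ * b ⁻¹)     ≈⟨ interchange a b (a ⁻¹) (b ⁻¹) ⟩
    a * a ⁻¹ * (b * b ⁻¹)     ≈⟨ *-cong (inverseʳ a a≉0) (inverseʳ b b≉0) ⟩
    1# * 1#                   ≈⟨ *-identityˡ 1# ⟩
    1#                        ∎))

  ^≈Exp^ : ∀ a n → a ^ n ≈ a Exp.^ n
  ^≈Exp^ a zero    = refl
  ^≈Exp^ a (suc n) = *-congˡ (^≈Exp^ a n)

  ^-cong : ∀ {a b} n → a ≈ b → a ^ n ≈ b ^ n
  ^-cong zero    a≈b = refl
  ^-cong (suc n) a≈b = *-cong a≈b (^-cong n a≈b)

  ^-homo-* : ∀ a m n → a ^ (m ℕ.+ n) ≈ a ^ m * a ^ n
  ^-homo-* a m n = trans (^≈Exp^ a (m ℕ.+ n))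
    (trans (Exp.^-homo-* a m n) (sym (*-cong (^≈Exp^ a m) (^≈Exp^ a n))))

  ^-distrib-* : ∀ a b n → (a * b) ^ n ≈ a ^ n * b ^ n
  ^-distrib-* a b n = trans (^≈Exp^ (a * b) n)
    (trans (CExp.^-distrib-* a b n) (sym (*-cong (^≈Exp^ a n) (^≈Exp^ b n))))

  ^-≉0 : ∀ {a} n → ¬ a ≈ 0# → ¬ a ^ n ≈ 0#
  ^-≉0 zero    a≉0 = 1≉0
  ^-≉0 (suc n) a≉0 = *-≉0 a≉0 (^-≉0 n a≉0)

  module _ {a : Carrier} (a≉0 : ¬ a ≈ 0#) where

    ^ᶻ-⊖ : ∀ m n → a ^ᶻ (m ⊖ n) ≈ a ^ m * (a ^ n) ⁻¹
    ^ᶻ-⊖ zero    zero    = sym (trans (*-congˡ 1⁻¹≈1) (*-identityˡ 1#))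
    ^ᶻ-⊖ zero    (suc n) = sym (*-identityˡ _)
    ^ᶻ-⊖ (suc m) zero    = sym (trans (*-congˡ 1⁻¹≈1) (*-identityʳ _))
    ^ᶻ-⊖ (suc m) (suc n) = begin
      a ^ᶻ (suc m ⊖ suc n)                  ≡⟨ ≡.cong (a ^ᶻ_) (ℤP.[1+m]⊖[1+n]≡m⊖n m n) ⟩
      a ^ᶻ (m ⊖ n)                          ≈⟨ ^ᶻ-⊖ m n ⟩
      a ^ m * (a ^ n) ⁻¹                    ≈⟨ *-identityˡ _ ⟨
      1# * (a ^ m * (a ^ n) ⁻¹)             ≈⟨ *-congʳ (inverseʳ a a≉0) ⟨
      a * a ⁻¹ * (a ^ m * (a ^ n) ⁻¹)       ≈⟨ interchange _ _ _ _ ⟩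
      a * a ^ m * (a ⁻¹ * (a ^ n) ⁻¹)       ≈⟨ *-congˡ (⁻¹-distrib-* a≉0 (^-≉0 n a≉0)) ⟨
      a ^ suc m * (a ^ suc n) ⁻¹            ∎

    ^ᶻ-homo-* : ∀ p q → a ^ᶻ (p ℤ.+ q) ≈ a ^ᶻ p * a ^ᶻ q
    ^ᶻ-homo-* (+ m)    (+ n)    = ^-homo-* a m n
    ^ᶻ-homo-* (+ m)    -[1+ n ] = ^ᶻ-⊖ m (suc n)
    ^ᶻ-homo-* -[1+ m ] (+ n)    = trans (^ᶻ-⊖ n (suc m)) (*-comm _ _)
    ^ᶻ-homo-* -[1+ m ] -[1+ n ] = begin
      (a ^ suc (suc (m ℕ.+ n))) ⁻¹          ≡⟨ ≡.cong (λ t → (a ^ suc t) ⁻¹) (ℕP.+-suc m n) ⟨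
      (a ^ (suc m ℕ.+ suc n)) ⁻¹            ≈⟨ ⁻¹-cong (^-homo-* a (suc m) (suc n)) ⟩
      (a ^ suc m * a ^ suc n) ⁻¹            ≈⟨ ⁻¹-distrib-* (^-≉0 (suc m) a≉0) (^-≉0 (suc n) a≉0) ⟩
      (a ^ suc m) ⁻¹ * (a ^ suc n) ⁻¹       ∎

    ^ᶻ-^ : ∀ p m → (a ^ᶻ p) ^ m ≈ a ^ᶻ (p ℤ.* + m)
    ^ᶻ-^ p zero    = reflexive (≡.cong (a ^ᶻ_) (≡.sym (ℤP.*-zeroʳ p)))
    ^ᶻ-^ p (suc m) = begin
      a ^ᶻ p * (a ^ᶻ p) ^ m          ≈⟨ *-congˡ (^ᶻ-^ p m) ⟩
      a ^ᶻ p * a ^ᶻ (p ℤ.* + m)      ≈⟨ ^ᶻ-homo-* p (p ℤ.* + m) ⟨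
      a ^ᶻ (p ℤ.+ p ℤ.* + m)         ≡⟨ ≡.cong (a ^ᶻ_) (ℤP.*-suc p (+ m)) ⟨
      a ^ᶻ (p ℤ.* + suc m)           ∎

  ^ᶻ-suc : ∀ a j → (j ℤ.< + 0 → ¬ a ≈ 0#) → a ^ᶻ (j ℤ.+ + 1) ≈ a * a ^ᶻ j
  ^ᶻ-suc a (+ m)    _   = reflexive (≡.cong (a ^_) (ℕP.+-comm m 1))
  ^ᶻ-suc a -[1+ m ] a≉0 = trans (^ᶻ-homo-* (a≉0 ℤ.-<+) -[1+ m ] (+ 1)) (trans (*-comm _ _) (*-congʳ (*-identityʳ a)))

  ^ᶻ-cong : ∀ {a b} p → a ≈ b → a ^ᶻ p ≈ b ^ᶻ p
  ^ᶻ-cong (+ m)    a≈b = ^-cong m a≈b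
  ^ᶻ-cong -[1+ m ] a≈b = ⁻¹-cong (^-cong (suc m) a≈b)

  ^ᶻ-distrib-* : ∀ {a b} → ¬ a ≈ 0# → ¬ b ≈ 0# → ∀ p → (a * b) ^ᶻ p ≈ a ^ᶻ p * b ^ᶻ p
  ^ᶻ-distrib-* a≉0 b≉0 (+ m)    = ^-distrib-* _ _ m
  ^ᶻ-distrib-* {a} {b} a≉0 b≉0 -[1+ m ] =
    trans (⁻¹-cong (^-distrib-* a b (suc m))) (⁻¹-distrib-* (^-≉0 (suc m) a≉0) (^-≉0 (suc m) b≉0))

  sum0to-cong : ∀ n {h h′ : ℕ → Carrier} → (∀ i → i ℕ.≤ n → h i ≈ h′ i) → sum0to n h ≈ sum0to n h′
  sum0to-cong zero    h≈h′ = h≈h′ 0 ℕ.z≤n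
  sum0to-cong (suc n) h≈h′ = +-cong (sum0to-cong n (λ i i≤n → h≈h′ i (ℕP.m≤n⇒m≤1+n i≤n))) (h≈h′ (suc n) ℕP.≤-refl)

  sum0to-+ : ∀ n (h₁ h₂ : ℕ → Carrier) → sum0to n (λ i → h₁ i + h₂ i) ≈ sum0to n h₁ + sum0to n h₂
  sum0to-+ zero    h₁ h₂ = refl
  sum0to-+ (suc n) h₁ h₂ = trans (+-congʳ (sum0to-+ n h₁ h₂)) (+-interchange _ _ _ _)

  sum0to-linear : ∀ n (α β γ : Carrier) (h₁ h₂ h₃ h₄ : ℕ → Carrier) →
    sum0to n (λ i → α * h₁ i - β * h₂ i - γ * h₃ i + h₄ i)
      ≈ α * sum0to n h₁ - β * sum0to n h₂ - γ * sum0to n h₃ + sum0to n h₄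
  sum0to-linear zero    α β γ h₁ h₂ h₃ h₄ = refl
  sum0to-linear (suc n) α β γ h₁ h₂ h₃ h₄ = trans (+-congʳ (sum0to-linear n α β γ h₁ h₂ h₃ h₄))
    (solve 11 (λ α β γ S₁ S₂ S₃ S₄ t₁ t₂ t₃ t₄ →
       (α :* S₁ :- β :* S₂ :- γ :* S₃ :+ S₄) :+ (α :* t₁ :- β :* t₂ :- γ :* t₃ :+ t₄)
       := α :* (S₁ :+ t₁) :- β :* (S₂ :+ t₂) :- γ :* (S₃ :+ t₃) :+ (S₄ :+ t₄)) refl _ _ _ _ _ _ _ _ _ _ _)

  binomial-theorem : ∀ n a b → (a + b) ^ n ≈ sum0to n (λ i → fromℕ (n C i) * (a ^ i * b ^ (n ∸ i)))
  binomial-theorem n a b = begin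
    (a + b) ^ n                            ≈⟨ ^≈Exp^ (a + b) n ⟩
    (a + b) Exp.^ n                        ≈⟨ Binomial.theorem n a b ⟩
    Binomial.binomialExpansion a b n       ≈⟨ Sum.sum-cong-≋ {suc n} (λ i → binomial-term (Fin.toℕ i)) ⟩
    Sum.sum {suc n} (λ i → t (Fin.toℕ i))  ≈⟨ sum≈sum0to n t ⟩
    sum0to n t                             ∎
    where
    import Algebra.Properties.CommutativeSemiring.Binomial commutativeSemiring as Binomial
    import Algebra.Properties.Semiring.Sum semiring as Sum
    open import Algebra.Properties.Semiring.Mult semiring using (_×_)
    import Data.Fin as Fin

    t : ℕ → Carrier
    t i = fromℕ (n C i) * (a ^ i * b ^ (n ∸ i))

    ×≈fromℕ* : ∀ m d → m × d ≈ fromℕ m * d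
    ×≈fromℕ* zero    d = sym (zeroˡ d)
    ×≈fromℕ* (suc m) d = trans (+-cong (sym (*-identityˡ d)) (×≈fromℕ* m d)) (sym (distribʳ _ _ _))

    binomial-term : ∀ i → (n C i) × (a Exp.^ i * b Exp.^ (n ∸ i)) ≈ t i
    binomial-term i = trans (×≈fromℕ* (n C i) _) (*-congˡ (sym (*-cong (^≈Exp^ a i) (^≈Exp^ b (n ∸ i)))))

    sum≈sum0to : ∀ m (h : ℕ → Carrier) → Sum.sum {suc m} (λ i → h (Fin.toℕ i)) ≈ sum0to m h
    sum≈sum0to zero    h = +-identityʳ (h 0)
    sum≈sum0to (suc m) h = trans (+-congˡ (sum≈sum0to m (λ i → h (suc i)))) (sym (sum0to-unroll m h))
      where
      sum0to-unroll : ∀ m (h : ℕ → Carrier) → sum0to (suc m) h ≈ h 0 + sum0to m (λ i → h (suc i))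
      sum0to-unroll zero    h = refl
      sum0to-unroll (suc m) h = trans (+-congʳ (sum0to-unroll m h)) (+-assoc _ _ _)

  sum0to-*ʳ : ∀ n (h : ℕ → Carrier) d → sum0to n h * d ≈ sum0to n (λ i → h i * d)
  sum0to-*ʳ zero    h d = refl
  sum0to-*ʳ (suc n) h d = trans (distribʳ d _ _) (+-congʳ (sum0to-*ʳ n h d))

  private
    sumUpTo-[-1] : ∀ (h : ℤ → Carrier) → sumUpTo -[1+ 0 ] h ≈ 0#
    sumUpTo-[-1] h = -0#≈0#

    sumUpTo-pred : ∀ m (h : ℤ → Carrier) → sumUpTo -[1+ suc m ] h ≈ sumUpTo -[1+ m ] h - h -[1+ m ]
    sumUpTo-pred m h = sym (⁻¹-∙-comm _ _)

  sumUpTo-cong : ∀ k {h h′ : ℤ → Carrier} → (∀ j → h j ≈ h′ j) → sumUpTo k h ≈ sumUpTo k h′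
  sumUpTo-cong (+ m)          h≈h′ = sum0to-cong m (λ i _ → h≈h′ (+ i))
  sumUpTo-cong -[1+ zero ]    h≈h′ = refl
  sumUpTo-cong -[1+ suc m ] {h} {h′} h≈h′ = begin
    sumUpTo -[1+ suc m ] h                ≈⟨ sumUpTo-pred m h ⟩
    sumUpTo -[1+ m ] h - h -[1+ m ]       ≈⟨ +-cong (sumUpTo-cong -[1+ m ] h≈h′) (-‿cong (h≈h′ -[1+ m ])) ⟩
    sumUpTo -[1+ m ] h′ - h′ -[1+ m ]     ≈⟨ sumUpTo-pred m h′ ⟨
    sumUpTo -[1+ suc m ] h′               ∎

  sumUpTo-+ : ∀ k (h₁ h₂ : ℤ → Carrier) → sumUpTo k (λ j → h₁ j + h₂ j) ≈ sumUpTo k h₁ + sumUpTo k h₂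
  sumUpTo-+ (+ m)         h₁ h₂ = sum0to-+ m (λ i → h₁ (+ i)) (λ i → h₂ (+ i))
  sumUpTo-+ -[1+ zero ]   h₁ h₂ = begin
    sumUpTo -[1+ 0 ] (λ j → h₁ j + h₂ j)  ≈⟨ sumUpTo-[-1] (λ j → h₁ j + h₂ j) ⟩
    0#                                     ≈⟨ +-identityʳ 0# ⟨
    0# + 0#                                ≈⟨ +-cong (sumUpTo-[-1] h₁) (sumUpTo-[-1] h₂) ⟨
    sumUpTo -[1+ 0 ] h₁ + sumUpTo -[1+ 0 ] h₂ ∎
  sumUpTo-+ -[1+ suc m ]  h₁ h₂ = begin
    sumUpTo -[1+ suc m ] (λ j → h₁ j + h₂ j)                     ≈⟨ sumUpTo-pred m _ ⟩
    sumUpTo -[1+ m ] (λ j → h₁ j + h₂ j) - (h₁ -[1+ m ] + h₂ -[1+ m ])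
                                                                  ≈⟨ +-congʳ (sumUpTo-+ -[1+ m ] h₁ h₂) ⟩
    (S₁ + S₂) - (h₁ -[1+ m ] + h₂ -[1+ m ])                       ≈⟨ solve 4 (λ S₁ S₂ t₁ t₂ →
                                                                        (S₁ :+ S₂) :- (t₁ :+ t₂) := (S₁ :- t₁) :+ (S₂ :- t₂))
                                                                        refl S₁ S₂ (h₁ -[1+ m ]) (h₂ -[1+ m ]) ⟩
    (S₁ - h₁ -[1+ m ]) + (S₂ - h₂ -[1+ m ])                       ≈⟨ +-cong (sumUpTo-pred m h₁) (sumUpTo-pred m h₂) ⟨
    sumUpTo -[1+ suc m ] h₁ + sumUpTo -[1+ suc m ] h₂            ∎
    where
    S₁ S₂ : Carrier
    S₁ = sumUpTo -[1+ m ] h₁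
    S₂ = sumUpTo -[1+ m ] h₂

  sumUpTo-*ˡ : ∀ k d (h : ℤ → Carrier) → sumUpTo k (λ j → d * h j) ≈ d * sumUpTo k h
  sumUpTo-*ˡ (+ m)        d h = sum0to-*ˡ m
    where
    sum0to-*ˡ : ∀ m → sum0to m (λ i → d * h (+ i)) ≈ d * sum0to m (λ i → h (+ i))
    sum0to-*ˡ zero    = refl
    sum0to-*ˡ (suc m) = trans (+-congʳ (sum0to-*ˡ m)) (sym (distribˡ d _ _))
  sumUpTo-*ˡ -[1+ zero ]  d h = begin
    sumUpTo -[1+ 0 ] (λ j → d * h j)   ≈⟨ sumUpTo-[-1] (λ j → d * h j) ⟩
    0#                                  ≈⟨ zeroʳ d ⟨
    d * 0#                              ≈⟨ *-congˡ (sumUpTo-[-1] h) ⟨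
    d * sumUpTo -[1+ 0 ] h              ∎
  sumUpTo-*ˡ -[1+ suc m ] d h = begin
    sumUpTo -[1+ suc m ] (λ j → d * h j)             ≈⟨ sumUpTo-pred m _ ⟩
    sumUpTo -[1+ m ] (λ j → d * h j) - d * h -[1+ m ] ≈⟨ +-congʳ (sumUpTo-*ˡ -[1+ m ] d h) ⟩
    d * sumUpTo -[1+ m ] h - d * h -[1+ m ]           ≈⟨ solve 3 (λ d S t → d :* S :- d :* t := d :* (S :- t)) refl d _ _ ⟩
    d * (sumUpTo -[1+ m ] h - h -[1+ m ])             ≈⟨ *-congˡ (sumUpTo-pred m h) ⟨
    d * sumUpTo -[1+ suc m ] h                        ∎

  sumUpTo-sum0to : ∀ k n (h : ℕ → ℤ → Carrier) →
    sumUpTo k (λ j → sum0to n (λ i → h i j)) ≈ sum0to n (λ i → sumUpTo k (h i))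
  sumUpTo-sum0to k zero    h = refl
  sumUpTo-sum0to k (suc n) h =
    trans (sumUpTo-+ k _ (h (suc n))) (+-congʳ (sumUpTo-sum0to k n h))

  -- The step is needed only at indices in the range of summation, which is negative only when k < -1.
  geometric-sum : ∀ k (q : ℤ → Carrier) d →
    (∀ j → (j ℤ.< + 0 → k ℤ.< -[1+ 0 ]) → q (j ℤ.+ + 1) ≈ d * q j) →
    (1# - d) * sumUpTo k q ≈ q (+ 0) - q (k ℤ.+ + 1)
  geometric-sum (+ m)    q d step = upward m
    where
    upward : ∀ m → (1# - d) * sum0to m (λ i → q (+ i)) ≈ q (+ 0) - q (+ m ℤ.+ + 1)
    upward zero    = trans (solve 2 (λ d t → (con (+ 1) :- d) :* t := t :- d :* t) refl d (q (+ 0)))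
                           (+-congˡ (-‿cong (sym (step (+ 0) (λ j<0 → contradiction j<0 ℤP.+≮0)))))
    upward (suc m) = begin
      (1# - d) * (S + t)                          ≈⟨ solve 3 (λ d S t → (con (+ 1) :- d) :* (S :+ t)
                                                        := (con (+ 1) :- d) :* S :+ (t :- d :* t)) refl d S t ⟩
      (1# - d) * S + (t - d * t)                  ≈⟨ +-cong (upward m) (+-congˡ (-‿cong (sym (step (+ suc m) (λ j<0 → contradiction j<0 ℤP.+≮0))))) ⟩
      (q (+ 0) - q (+ m ℤ.+ + 1)) + (t - q (+ suc m ℤ.+ + 1))
                                                  ≡⟨ ≡.cong (λ l → (q (+ 0) - q (+ l)) + (t - q (+ suc m ℤ.+ + 1))) (ℕP.+-comm m 1) ⟩
      (q (+ 0) - t) + (t - q (+ suc m ℤ.+ + 1))   ≈⟨ solve 3 (λ a b c → (a :- b) :+ (b :- c) := a :- c) refl _ _ _ ⟩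
      q (+ 0) - q (+ suc m ℤ.+ + 1)               ∎
      where
      S t : Carrier
      S = sum0to m (λ i → q (+ i))
      t = q (+ suc m)
  geometric-sum -[1+ m ] q d step = downward m (λ u u<m → step -[1+ u ] (λ _ → ℤ.-<- (ℕP.≤-trans (ℕ.s≤s ℕ.z≤n) u<m)))
    where
    downward : ∀ m → (∀ u → u ℕ.< m → q (-[1+ u ] ℤ.+ + 1) ≈ d * q -[1+ u ]) →
               (1# - d) * sumUpTo -[1+ m ] q ≈ q (+ 0) - q (-[1+ m ] ℤ.+ + 1)
    downward zero    _     = solve 2 (λ d a → (con (+ 1) :- d) :* (:- con (+ 0)) := a :- a) refl d (q (+ 0))
    downward (suc m) step′ = begin
      (1# - d) * sumUpTo -[1+ suc m ] q           ≈⟨ *-congˡ (sumUpTo-pred m q) ⟩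
      (1# - d) * (S - t)                          ≈⟨ solve 3 (λ d S t → (con (+ 1) :- d) :* (S :- t)
                                                        := (con (+ 1) :- d) :* S :- (t :- d :* t)) refl d S t ⟩
      (1# - d) * S - (t - d * t)                  ≈⟨ +-cong (downward m (λ u u<m → step′ u (ℕP.m≤n⇒m≤1+n u<m)))
                                                            (-‿cong (+-congˡ (-‿cong (sym (step′ m ℕP.≤-refl))))) ⟩
      (q (+ 0) - q (-[1+ m ] ℤ.+ + 1)) - (t - q (-[1+ m ] ℤ.+ + 1))
                                                  ≈⟨ solve 3 (λ a b c → (a :- c) :- (b :- c) := a :- b) refl _ t _ ⟩
      q (+ 0) - t                                 ≡⟨ ≡.cong (λ l → q (+ 0) - q l) (ℤP.[1+m]⊖[1+n]≡m⊖n 0 (suc m)) ⟨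
      q (+ 0) - q (-[1+ suc m ] ℤ.+ + 1)          ∎
      where
      S t : Carrier
      S = sumUpTo -[1+ m ] q
      t = q -[1+ m ]

  cancel-factor : ∀ {A B G R D} → A * G ≈ R → D ≈ A * B → ¬ D ≈ 0# → G ≈ R * B / D
  cancel-factor {A} {B} {G} {R} {D} AG≈R D≈AB D≉0 = begin
    G                     ≈⟨ *-identityʳ G ⟨
    G * 1#                ≈⟨ *-congˡ (inverseʳ D D≉0) ⟨
    G * (D * D ⁻¹)        ≈⟨ *-congˡ (*-congʳ D≈AB) ⟩
    G * (A * B * D ⁻¹)    ≈⟨ solve 4 (λ G A B D⁻¹ → G :* (A :* B :* D⁻¹) := A :* G :* B :* D⁻¹) refl G A B (D ⁻¹) ⟩
    A * G * B * D ⁻¹      ≈⟨ *-congʳ (*-congʳ AG≈R) ⟩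
    R * B * D ⁻¹          ∎

  module PowerSum (z : Carrier) (k r s : ℤ) (n : ℕ) (hz : k ℤ.< -[1+ 0 ] → ¬ z ≈ 0#) where

    N : ℤ
    N = + n

    e A₁ B₁ A₂ B₂ A₃ B₃ : ℕ → ℤ
    e i  = s ℤ.* (N ℤ.- + 2 ℤ.* + i)
    A₁ i = e i ℤ.+ r ℤ.* N ℤ.* (k ℤ.+ + 1) ℤ.- r ℤ.* (+ i) ℤ.* k
    B₁ i = r ℤ.* ((+ i) ℤ.* k ℤ.+ N)
    A₂ i = e i ℤ.+ (r ℤ.* N ℤ.- r ℤ.* (+ i)) ℤ.* (k ℤ.+ + 1)
    B₂ i = r ℤ.* (+ i) ℤ.* (k ℤ.+ + 1)
    A₃ i = e i ℤ.+ r ℤ.* (+ i)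
    B₃ i = r ℤ.* (N ℤ.- + i)

    z-step : ∀ j → (j ℤ.< + 0 → k ℤ.< -[1+ 0 ]) → z ^ᶻ (j ℤ.+ + 1) ≈ z * z ^ᶻ j
    z-step j j<0⇒k<-1 = ^ᶻ-suc z j (λ j<0 → hz (j<0⇒k<-1 j<0))

    z^[k+1]*z≈z^[k+2] : z ^ᶻ (k ℤ.+ + 1) * z ≈ z ^ᶻ (k ℤ.+ + 2)
    z^[k+1]*z≈z^[k+2] = begin
      z ^ᶻ (k ℤ.+ + 1) * z               ≈⟨ *-comm _ z ⟩
      z * z ^ᶻ (k ℤ.+ + 1)               ≈⟨ z-step (k ℤ.+ + 1) (k+1<0⇒k<-1 k) ⟨
      z ^ᶻ (k ℤ.+ + 1 ℤ.+ + 1)           ≡⟨ ≡.cong (z ^ᶻ_) (ℤP.+-assoc k (+ 1) (+ 1)) ⟩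
      z ^ᶻ (k ℤ.+ + 2)                   ∎
      where
      k+1<0⇒k<-1 : ∀ k → k ℤ.+ + 1 ℤ.< + 0 → k ℤ.< -[1+ 0 ]
      k+1<0⇒k<-1 (+ m)          k+1<0 = contradiction k+1<0 ℤP.+≮0
      k+1<0⇒k<-1 -[1+ zero ]    k+1<0 = contradiction k+1<0 ℤP.+≮0
      k+1<0⇒k<-1 -[1+ suc m ]   _     = ℤ.-<- (ℕ.s≤s ℕ.z≤n)

    module Expansion (f g x y : Carrier) (x≉0 : ¬ x ≈ 0#) (y≉0 : ¬ y ≈ 0#) where

      mono : ℤ → ℤ → Carrier
      mono p q = x ^ᶻ p * y ^ᶻ q

      mono-≡ : ∀ {p q p′ q′} → p ≡ p′ → q ≡ q′ → mono p q ≈ mono p′ q′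
      mono-≡ p≡p′ q≡q′ = reflexive (≡.cong₂ mono p≡p′ q≡q′)

      mono-* : ∀ p q p′ q′ → mono p q * mono p′ q′ ≈ mono (p ℤ.+ p′) (q ℤ.+ q′)
      mono-* p q p′ q′ = trans (interchange _ _ _ _) (sym (*-cong (^ᶻ-homo-* x≉0 p p′) (^ᶻ-homo-* y≉0 q q′)))

      [xy]^ᶻ-* : ∀ t p q → (x * y) ^ᶻ t * mono p q ≈ mono (t ℤ.+ p) (t ℤ.+ q)
      [xy]^ᶻ-* t p q = trans (*-congʳ (^ᶻ-distrib-* x≉0 y≉0 t)) (mono-* t t p q)

      D : ℕ → Carrier
      D i = (x * y) ^ᶻ (r ℤ.* N) * (z ^ 2)
            - (x * y) ^ᶻ (r ℤ.* (+ i))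
              * (x ^ᶻ (r ℤ.* (N ℤ.- + 2 ℤ.* + i)) + y ^ᶻ (r ℤ.* (N ℤ.- + 2 ℤ.* + i))) * z
            + 1#

      -- The second term of the bracket in the theorem; the instance Expansion g f y x yields the first.
      half-summand : (ℕ → ℤ) → (ℕ → ℤ) → ℕ → Carrier
      half-summand a b i = (x * y) ^ᶻ (s ℤ.* (+ i)) * fromℕ (n C i)
                           * (f ^ i * g ^ (n ∸ i) * x ^ᶻ b i * y ^ᶻ a i / D i)

      ratio mirror-ratio weight : ℕ → Carrier
      ratio i        = mono (r ℤ.* + i) (r ℤ.* (N ℤ.- + i))
      mirror-ratio i = mono (r ℤ.* (N ℤ.- + i)) (r ℤ.* + i)
      weight i       = mono (s ℤ.* + i) (s ℤ.* (N ℤ.- + i))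

      ratio^ : ℕ → ℤ → Carrier
      ratio^ i j = mono (r ℤ.* + i ℤ.* j) (r ℤ.* (N ℤ.- + i) ℤ.* j)

      D-factorisation : ∀ i → D i ≈ (1# - ratio i * z) * (1# - mirror-ratio i * z)
      D-factorisation i = begin
        D i                                          ≈⟨ +-congʳ (+-cong (*-congʳ [xy]^rN≈product) (-‿cong (*-congʳ [xy]^ri*sum≈sum))) ⟩
        ratio i * mirror-ratio i * (z * (z * 1#)) - (mirror-ratio i + ratio i) * z + 1#
                                                     ≈⟨ solve 3 (λ a b z → a :* b :* (z :* (z :* con (+ 1))) :- (b :+ a) :* z :+ con (+ 1)
                                                                     := (con (+ 1) :- a :* z) :* (con (+ 1) :- b :* z))
                                                                   refl (ratio i) (mirror-ratio i) z ⟩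
        (1# - ratio i * z) * (1# - mirror-ratio i * z) ∎
        where
        I E : ℤ
        I = + i
        E = r ℤ.* (N ℤ.- + 2 ℤ.* I)

        [xy]^rN≈product : (x * y) ^ᶻ (r ℤ.* N) ≈ ratio i * mirror-ratio i
        [xy]^rN≈product = begin
          (x * y) ^ᶻ (r ℤ.* N)                                 ≈⟨ ^ᶻ-distrib-* x≉0 y≉0 (r ℤ.* N) ⟩
          mono (r ℤ.* N) (r ℤ.* N)                              ≈⟨ mono-≡ (split r N I) (≡.trans (split r N I) (ℤP.+-comm (r ℤ.* I) (r ℤ.* (N ℤ.- I)))) ⟩
          mono (r ℤ.* I ℤ.+ r ℤ.* (N ℤ.- I)) (r ℤ.* (N ℤ.- I) ℤ.+ r ℤ.* I) ≈⟨ mono-* (r ℤ.* I) (r ℤ.* (N ℤ.- I)) (r ℤ.* (N ℤ.- I)) (r ℤ.* I) ⟨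
          ratio i * mirror-ratio i                              ∎
          where
          split : ∀ r N I → r ℤ.* N ≡ r ℤ.* I ℤ.+ r ℤ.* (N ℤ.- I)
          split = ℤSolver.solve-∀

        [xy]^ri*sum≈sum : (x * y) ^ᶻ (r ℤ.* I) * (x ^ᶻ E + y ^ᶻ E) ≈ mirror-ratio i + ratio i
        [xy]^ri*sum≈sum = trans (distribˡ _ _ _) (+-cong left right)
          where
          shift : ∀ r N I → r ℤ.* I ℤ.+ r ℤ.* (N ℤ.- + 2 ℤ.* I) ≡ r ℤ.* (N ℤ.- I)
          shift = ℤSolver.solve-∀
          left : (x * y) ^ᶻ (r ℤ.* I) * x ^ᶻ E ≈ mirror-ratio i
          left = begin
            (x * y) ^ᶻ (r ℤ.* I) * x ^ᶻ E           ≈⟨ *-congˡ (*-identityʳ _) ⟨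
            (x * y) ^ᶻ (r ℤ.* I) * mono E (+ 0)     ≈⟨ [xy]^ᶻ-* (r ℤ.* I) E (+ 0) ⟩
            mono (r ℤ.* I ℤ.+ E) (r ℤ.* I ℤ.+ + 0)  ≈⟨ mono-≡ (shift r N I) (ℤP.+-identityʳ (r ℤ.* I)) ⟩
            mirror-ratio i                          ∎
          right : (x * y) ^ᶻ (r ℤ.* I) * y ^ᶻ E ≈ ratio i
          right = begin
            (x * y) ^ᶻ (r ℤ.* I) * y ^ᶻ E           ≈⟨ *-congˡ (*-identityˡ _) ⟨
            (x * y) ^ᶻ (r ℤ.* I) * mono (+ 0) E     ≈⟨ [xy]^ᶻ-* (r ℤ.* I) (+ 0) E ⟩
            mono (r ℤ.* I ℤ.+ + 0) (r ℤ.* I ℤ.+ E)  ≈⟨ mono-≡ (ℤP.+-identityʳ (r ℤ.* I)) (shift r N I) ⟩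
            ratio i                                 ∎

      series : ℕ → Carrier
      series i = sumUpTo k (λ j → ratio^ i j * z ^ᶻ j)

      series-geometric : ∀ i → (1# - ratio i * z) * series i ≈ 1# - ratio^ i (k ℤ.+ + 1) * z ^ᶻ (k ℤ.+ + 1)
      series-geometric i = trans (geometric-sum k (λ j → ratio^ i j * z ^ᶻ j) (ratio i * z) step) (+-congʳ first≈1)
        where
        I : ℤ
        I = + i
        ratio^-suc : ∀ j → ratio^ i (j ℤ.+ + 1) ≈ ratio i * ratio^ i j
        ratio^-suc j = begin
          ratio^ i (j ℤ.+ + 1)                                          ≈⟨ mono-≡ (*-suc (r ℤ.* I) j) (*-suc (r ℤ.* (N ℤ.- I)) j) ⟩
          mono (r ℤ.* I ℤ.+ r ℤ.* I ℤ.* j) (r ℤ.* (N ℤ.- I) ℤ.+ r ℤ.* (N ℤ.- I) ℤ.* j)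
                                                                         ≈⟨ mono-* (r ℤ.* I) (r ℤ.* (N ℤ.- I)) (r ℤ.* I ℤ.* j) (r ℤ.* (N ℤ.- I) ℤ.* j) ⟨
          ratio i * ratio^ i j                                          ∎
          where
          *-suc : ∀ p j → p ℤ.* (j ℤ.+ + 1) ≡ p ℤ.+ p ℤ.* j
          *-suc = ℤSolver.solve-∀
        step : ∀ j → (j ℤ.< + 0 → k ℤ.< -[1+ 0 ]) →
               ratio^ i (j ℤ.+ + 1) * z ^ᶻ (j ℤ.+ + 1) ≈ ratio i * z * (ratio^ i j * z ^ᶻ j)
        step j j<0⇒k<-1 = trans (*-cong (ratio^-suc j) (z-step j j<0⇒k<-1)) (interchange _ _ _ _)
        first≈1 : ratio^ i (+ 0) * z ^ᶻ (+ 0) ≈ 1#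
        first≈1 = trans (*-identityʳ _) (trans (mono-≡ (ℤP.*-zeroʳ (r ℤ.* I)) (ℤP.*-zeroʳ (r ℤ.* (N ℤ.- I)))) (*-identityʳ 1#))

      series-closed-form : ∀ i → ¬ D i ≈ 0# →
        series i ≈ (1# - ratio^ i (k ℤ.+ + 1) * z ^ᶻ (k ℤ.+ + 1)) * (1# - mirror-ratio i * z) / D i
      series-closed-form i D≉0 = cancel-factor (series-geometric i) (D-factorisation i) D≉0

      module _ (i : ℕ) where
        private
          I K : ℤ
          I = + i
          K = k ℤ.+ + 1
          X : Carrier
          X = (x * y) ^ᶻ (s ℤ.* I)

        weight≈ : weight i ≈ X * mono (+ 0) (e i)
        weight≈ = begin
          weight i                                   ≈⟨ mono-≡ (≡.sym (ℤP.+-identityʳ (s ℤ.* I))) (halve s N I) ⟩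
          mono (s ℤ.* I ℤ.+ + 0) (s ℤ.* I ℤ.+ e i)   ≈⟨ [xy]^ᶻ-* (s ℤ.* I) (+ 0) (e i) ⟨
          X * mono (+ 0) (e i)                       ∎
          where
          halve : ∀ s N I → s ℤ.* (N ℤ.- I) ≡ s ℤ.* I ℤ.+ s ℤ.* (N ℤ.- + 2 ℤ.* I)
          halve = ℤSolver.solve-∀

        weight*mirror-ratio : weight i * mirror-ratio i ≈ X * mono (B₃ i) (A₃ i)
        weight*mirror-ratio = begin
          weight i * mirror-ratio i                                   ≈⟨ mono-* (s ℤ.* I) (s ℤ.* (N ℤ.- I)) (r ℤ.* (N ℤ.- I)) (r ℤ.* I) ⟩
          mono (s ℤ.* I ℤ.+ B₃ i) (s ℤ.* (N ℤ.- I) ℤ.+ r ℤ.* I)       ≈⟨ *-congˡ (reflexive (≡.cong (y ^ᶻ_) (exponent r s N I))) ⟩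
          mono (s ℤ.* I ℤ.+ B₃ i) (s ℤ.* I ℤ.+ A₃ i)                  ≈⟨ [xy]^ᶻ-* (s ℤ.* I) (B₃ i) (A₃ i) ⟨
          X * mono (B₃ i) (A₃ i)                                      ∎
          where
          exponent : ∀ r s N I → s ℤ.* (N ℤ.- I) ℤ.+ r ℤ.* I ≡ s ℤ.* I ℤ.+ (s ℤ.* (N ℤ.- + 2 ℤ.* I) ℤ.+ r ℤ.* I)
          exponent = ℤSolver.solve-∀

        weight*ratio^ : weight i * ratio^ i K ≈ X * mono (B₂ i) (A₂ i)
        weight*ratio^ = begin
          weight i * ratio^ i K                                       ≈⟨ mono-* (s ℤ.* I) (s ℤ.* (N ℤ.- I)) (r ℤ.* I ℤ.* K) (r ℤ.* (N ℤ.- I) ℤ.* K) ⟩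
          mono (s ℤ.* I ℤ.+ B₂ i) (s ℤ.* (N ℤ.- I) ℤ.+ r ℤ.* (N ℤ.- I) ℤ.* K)
                                                                      ≈⟨ *-congˡ (reflexive (≡.cong (y ^ᶻ_) (exponent r s k N I))) ⟩
          mono (s ℤ.* I ℤ.+ B₂ i) (s ℤ.* I ℤ.+ A₂ i)                  ≈⟨ [xy]^ᶻ-* (s ℤ.* I) (B₂ i) (A₂ i) ⟨
          X * mono (B₂ i) (A₂ i)                                      ∎
          where
          exponent : ∀ r s k N I → s ℤ.* (N ℤ.- I) ℤ.+ r ℤ.* (N ℤ.- I) ℤ.* (k ℤ.+ + 1)
                                   ≡ s ℤ.* I ℤ.+ (s ℤ.* (N ℤ.- + 2 ℤ.* I) ℤ.+ (r ℤ.* N ℤ.- r ℤ.* I) ℤ.* (k ℤ.+ + 1))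
          exponent = ℤSolver.solve-∀

        weight*ratio^*mirror-ratio : weight i * ratio^ i K * mirror-ratio i ≈ X * mono (B₁ i) (A₁ i)
        weight*ratio^*mirror-ratio = begin
          weight i * ratio^ i K * mirror-ratio i                      ≈⟨ *-congʳ (mono-* (s ℤ.* I) (s ℤ.* (N ℤ.- I)) (r ℤ.* I ℤ.* K) (r ℤ.* (N ℤ.- I) ℤ.* K)) ⟩
          mono p q * mirror-ratio i                                   ≈⟨ mono-* p q (r ℤ.* (N ℤ.- I)) (r ℤ.* I) ⟩
          mono (p ℤ.+ r ℤ.* (N ℤ.- I)) (q ℤ.+ r ℤ.* I)                ≈⟨ mono-≡ (exponentˣ r s k N I) (exponentʸ r s k N I) ⟩
          mono (s ℤ.* I ℤ.+ B₁ i) (s ℤ.* I ℤ.+ A₁ i)                  ≈⟨ [xy]^ᶻ-* (s ℤ.* I) (B₁ i) (A₁ i) ⟨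
          X * mono (B₁ i) (A₁ i)                                      ∎
          where
          p q : ℤ
          p = s ℤ.* I ℤ.+ r ℤ.* I ℤ.* K
          q = s ℤ.* (N ℤ.- I) ℤ.+ r ℤ.* (N ℤ.- I) ℤ.* K
          exponentˣ : ∀ r s k N I → s ℤ.* I ℤ.+ r ℤ.* I ℤ.* (k ℤ.+ + 1) ℤ.+ r ℤ.* (N ℤ.- I)
                                    ≡ s ℤ.* I ℤ.+ r ℤ.* (I ℤ.* k ℤ.+ N)
          exponentˣ = ℤSolver.solve-∀
          exponentʸ : ∀ r s k N I → s ℤ.* (N ℤ.- I) ℤ.+ r ℤ.* (N ℤ.- I) ℤ.* (k ℤ.+ + 1) ℤ.+ r ℤ.* I
                                    ≡ s ℤ.* I ℤ.+ (s ℤ.* (N ℤ.- + 2 ℤ.* I) ℤ.+ r ℤ.* N ℤ.* (k ℤ.+ + 1) ℤ.- r ℤ.* I ℤ.* k)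
          exponentʸ = ℤSolver.solve-∀

      coefficient : ℕ → Carrier
      coefficient i = fromℕ (n C i) * (f ^ i * g ^ (n ∸ i)) * weight i

      binomial-summand : ∀ i j → i ℕ.≤ n →
        fromℕ (n C i) * ((f * x ^ᶻ (r ℤ.* j ℤ.+ s)) ^ i * (g * y ^ᶻ (r ℤ.* j ℤ.+ s)) ^ (n ∸ i))
          ≈ coefficient i * ratio^ i j
      binomial-summand i j i≤n = begin
        binom * ((f * x ^ᶻ t) ^ i * (g * y ^ᶻ t) ^ (n ∸ i))
          ≈⟨ *-congˡ (*-cong (^-distrib-* f (x ^ᶻ t) i) (^-distrib-* g (y ^ᶻ t) (n ∸ i))) ⟩
        binom * (f ^ i * (x ^ᶻ t) ^ i * (g ^ (n ∸ i) * (y ^ᶻ t) ^ (n ∸ i)))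
          ≈⟨ *-congˡ (*-cong (*-congˡ (^ᶻ-^ x≉0 t i)) (*-congˡ (^ᶻ-^ y≉0 t (n ∸ i)))) ⟩
        binom * (f ^ i * x ^ᶻ (t ℤ.* I) * (g ^ (n ∸ i) * y ^ᶻ (t ℤ.* + (n ∸ i))))
          ≈⟨ solve 5 (λ C F X G Y → C :* (F :* X :* (G :* Y)) := C :* (F :* G) :* (X :* Y))
                     refl binom (f ^ i) (x ^ᶻ (t ℤ.* I)) (g ^ (n ∸ i)) (y ^ᶻ (t ℤ.* + (n ∸ i))) ⟩
        binom * (f ^ i * g ^ (n ∸ i)) * mono (t ℤ.* I) (t ℤ.* + (n ∸ i))
          ≈⟨ *-congˡ (mono-≡ (expand r s j I) (≡.trans (≡.cong (t ℤ.*_) n∸i≡N-I) (expand r s j (N ℤ.- I)))) ⟩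
        binom * (f ^ i * g ^ (n ∸ i)) * mono (s ℤ.* I ℤ.+ r ℤ.* I ℤ.* j) (s ℤ.* (N ℤ.- I) ℤ.+ r ℤ.* (N ℤ.- I) ℤ.* j)
          ≈⟨ *-congˡ (mono-* (s ℤ.* I) (s ℤ.* (N ℤ.- I)) (r ℤ.* I ℤ.* j) (r ℤ.* (N ℤ.- I) ℤ.* j)) ⟨
        binom * (f ^ i * g ^ (n ∸ i)) * (weight i * ratio^ i j)
          ≈⟨ *-assoc _ _ _ ⟨
        coefficient i * ratio^ i j ∎
        where
        binom : Carrier
        binom = fromℕ (n C i)
        I t : ℤ
        I = + i
        t = r ℤ.* j ℤ.+ s
        expand : ∀ r s j u → (r ℤ.* j ℤ.+ s) ℤ.* u ≡ s ℤ.* u ℤ.+ r ℤ.* u ℤ.* j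
        expand = ℤSolver.solve-∀
        n∸i≡N-I : + (n ∸ i) ≡ N ℤ.- I
        n∸i≡N-I = ≡.trans (≡.sym (ℤP.⊖-≥ i≤n)) (≡.sym (ℤP.m-n≡m⊖n n i))

      power-sum-expansion :
        sumUpTo k (λ j → (f * x ^ᶻ (r ℤ.* j ℤ.+ s) + g * y ^ᶻ (r ℤ.* j ℤ.+ s)) ^ n * z ^ᶻ j)
          ≈ sum0to n (λ i → coefficient i * series i)
      power-sum-expansion = begin
        sumUpTo k (λ j → (fX j + gY j) ^ n * z ^ᶻ j)
          ≈⟨ sumUpTo-cong k summand ⟩
        sumUpTo k (λ j → sum0to n (λ i → coefficient i * (ratio^ i j * z ^ᶻ j)))
          ≈⟨ sumUpTo-sum0to k n _ ⟩
        sum0to n (λ i → sumUpTo k (λ j → coefficient i * (ratio^ i j * z ^ᶻ j)))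
          ≈⟨ sum0to-cong n (λ i _ → sumUpTo-*ˡ k (coefficient i) _) ⟩
        sum0to n (λ i → coefficient i * series i) ∎
        where
        fX gY : ℤ → Carrier
        fX j = f * x ^ᶻ (r ℤ.* j ℤ.+ s)
        gY j = g * y ^ᶻ (r ℤ.* j ℤ.+ s)
        summand : ∀ j → (fX j + gY j) ^ n * z ^ᶻ j ≈ sum0to n (λ i → coefficient i * (ratio^ i j * z ^ᶻ j))
        summand j = begin
          (fX j + gY j) ^ n * z ^ᶻ j
            ≈⟨ *-congʳ (binomial-theorem n (fX j) (gY j)) ⟩
          sum0to n (λ i → fromℕ (n C i) * (fX j ^ i * gY j ^ (n ∸ i))) * z ^ᶻ j
            ≈⟨ sum0to-*ʳ n _ (z ^ᶻ j) ⟩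
          sum0to n (λ i → fromℕ (n C i) * (fX j ^ i * gY j ^ (n ∸ i)) * z ^ᶻ j)
            ≈⟨ sum0to-cong n (λ i i≤n → trans (*-congʳ (binomial-summand i j i≤n)) (*-assoc _ _ _)) ⟩
          sum0to n (λ i → coefficient i * (ratio^ i j * z ^ᶻ j)) ∎

      coefficient*series : ∀ i → ¬ D i ≈ 0# →
        coefficient i * series i
          ≈ z ^ᶻ (k ℤ.+ + 2) * half-summand A₁ B₁ i - z ^ᶻ (k ℤ.+ + 1) * half-summand A₂ B₂ i - z * half-summand A₃ B₃ i + half-summand e (λ _ → + 0) i
      coefficient*series i D≉0 = begin
        binom * fg * w * series i
          ≈⟨ *-congˡ (series-closed-form i D≉0) ⟩
        binom * fg * w * ((1# - ρ * Z₁) * (1# - ρ′ * z) * D⁻¹)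
          ≈⟨ solve 8 (λ c fg w ρ Z₁ ρ′ z D⁻¹ →
               c :* fg :* w :* ((con (+ 1) :- ρ :* Z₁) :* (con (+ 1) :- ρ′ :* z) :* D⁻¹)
               := c :* fg :* D⁻¹ :* (w :- z :* (w :* ρ′) :- Z₁ :* (w :* ρ) :+ (Z₁ :* z) :* (w :* ρ :* ρ′)))
             refl binom fg w ρ Z₁ ρ′ z D⁻¹ ⟩
        binom * fg * D⁻¹ * (w - z * (w * ρ′) - Z₁ * (w * ρ) + (Z₁ * z) * (w * ρ * ρ′))
          ≈⟨ *-congˡ (+-cong (+-cong (+-cong (weight≈ i) (-‿cong (*-congˡ (weight*mirror-ratio i))))
                                     (-‿cong (*-congˡ (weight*ratio^ i))))
                             (*-cong z^[k+1]*z≈z^[k+2] (weight*ratio^*mirror-ratio i))) ⟩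
        binom * fg * D⁻¹ * (X * mono (+ 0) (e i) - z * (X * mono (B₃ i) (A₃ i))
                           - Z₁ * (X * mono (B₂ i) (A₂ i)) + Z₂ * (X * mono (B₁ i) (A₁ i)))
          ≈⟨ solve 15 (λ c fg D⁻¹ X z Z₁ Z₂ x₁ y₁ x₂ y₂ x₃ y₃ x₄ y₄ →
               c :* fg :* D⁻¹ :* (X :* (x₄ :* y₄) :- z :* (X :* (x₃ :* y₃)) :- Z₁ :* (X :* (x₂ :* y₂)) :+ Z₂ :* (X :* (x₁ :* y₁)))
               := Z₂ :* (X :* c :* (fg :* x₁ :* y₁ :* D⁻¹)) :- Z₁ :* (X :* c :* (fg :* x₂ :* y₂ :* D⁻¹))
                  :- z :* (X :* c :* (fg :* x₃ :* y₃ :* D⁻¹)) :+ X :* c :* (fg :* x₄ :* y₄ :* D⁻¹))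
             refl binom fg D⁻¹ X z Z₁ Z₂ (x ^ᶻ B₁ i) (y ^ᶻ A₁ i) (x ^ᶻ B₂ i) (y ^ᶻ A₂ i)
                  (x ^ᶻ B₃ i) (y ^ᶻ A₃ i) (x ^ᶻ (+ 0)) (y ^ᶻ e i) ⟩
        Z₂ * half-summand A₁ B₁ i - Z₁ * half-summand A₂ B₂ i - z * half-summand A₃ B₃ i + half-summand e (λ _ → + 0) i ∎
        where
        binom fg w ρ ρ′ X Z₁ Z₂ D⁻¹ : Carrier
        binom = fromℕ (n C i)
        fg     = f ^ i * g ^ (n ∸ i)
        w     = weight i
        ρ     = ratio^ i (k ℤ.+ + 1)
        ρ′    = mirror-ratio i
        X     = (x * y) ^ᶻ (s ℤ.* + i)
        Z₁    = z ^ᶻ (k ℤ.+ + 1)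
        Z₂    = z ^ᶻ (k ℤ.+ + 2)
        D⁻¹   = D i ⁻¹

    module _ (f g x y : Carrier) (x≉0 : ¬ x ≈ 0#) (y≉0 : ¬ y ≈ 0#) where
      open Expansion f g x y x≉0 y≉0
      private module Mirror = Expansion g f y x y≉0 x≉0

      summand : (ℕ → ℤ) → (ℕ → ℤ) → ℕ → Carrier
      summand a b i = (x * y) ^ᶻ (s ℤ.* (+ i)) * fromℕ (n C i)
                      * ((f ^ (n ∸ i) * g ^ i * x ^ᶻ a i * y ^ᶻ b i
                          + f ^ i * g ^ (n ∸ i) * x ^ᶻ b i * y ^ᶻ a i) / D i)

      D-mirror : ∀ i → Mirror.D i ≈ D i
      D-mirror i = +-congʳ (+-cong (*-congʳ (^ᶻ-cong (r ℤ.* N) (*-comm y x)))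
                                   (-‿cong (*-congʳ (*-cong (^ᶻ-cong (r ℤ.* + i) (*-comm y x)) (+-comm _ _)))))

      half-summand-pair : ∀ a b i → Mirror.half-summand a b i + half-summand a b i ≈ summand a b i
      half-summand-pair a b i = begin
        Mirror.half-summand a b i + half-summand a b i
          ≈⟨ +-congʳ (*-cong (*-congʳ (^ᶻ-cong (s ℤ.* + i) (*-comm y x))) (*-cong numerators (⁻¹-cong (D-mirror i)))) ⟩
        X * binom * (t₁ * D i ⁻¹) + X * binom * (t₂ * D i ⁻¹)
          ≈⟨ solve 5 (λ X c t₁ t₂ D⁻¹ → X :* c :* (t₁ :* D⁻¹) :+ X :* c :* (t₂ :* D⁻¹) := X :* c :* ((t₁ :+ t₂) :* D⁻¹))
                     refl X binom t₁ t₂ (D i ⁻¹) ⟩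
        summand a b i ∎
        where
        X binom t₁ t₂ : Carrier
        X     = (x * y) ^ᶻ (s ℤ.* (+ i))
        binom = fromℕ (n C i)
        t₁    = f ^ (n ∸ i) * g ^ i * x ^ᶻ a i * y ^ᶻ b i
        t₂    = f ^ i * g ^ (n ∸ i) * x ^ᶻ b i * y ^ᶻ a i
        numerators : g ^ i * f ^ (n ∸ i) * y ^ᶻ b i * x ^ᶻ a i ≈ t₁
        numerators = solve 4 (λ G F Y X → G :* F :* Y :* X := F :* G :* X :* Y) refl _ _ _ _

      power-sum-closed-form : (∀ i → i ℕ.≤ n → ¬ D i ≈ 0#) →
        (1# + 1#) * sumUpTo k (λ j → (f * x ^ᶻ (r ℤ.* j ℤ.+ s) + g * y ^ᶻ (r ℤ.* j ℤ.+ s)) ^ n * z ^ᶻ j)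
          ≈ z ^ᶻ (k ℤ.+ + 2) * sum0to n (summand A₁ B₁) - z ^ᶻ (k ℤ.+ + 1) * sum0to n (summand A₂ B₂)
            - z * sum0to n (summand A₃ B₃) + sum0to n (summand e (λ _ → + 0))
      power-sum-closed-form D≉0 = begin
        (1# + 1#) * S
          ≈⟨ trans (distribʳ S 1# 1#) (+-cong (*-identityˡ S) (*-identityˡ S)) ⟩
        S + S
          ≈⟨ +-cong (trans (sumUpTo-cong k (λ j → *-congʳ (^-cong n (+-comm _ _)))) Mirror.power-sum-expansion)
                    power-sum-expansion ⟩
        sum0to n (λ i → Mirror.coefficient i * Mirror.series i) + sum0to n (λ i → coefficient i * series i)
          ≈⟨ sum0to-+ n _ _ ⟨
        sum0to n (λ i → Mirror.coefficient i * Mirror.series i + coefficient i * series i)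
          ≈⟨ sum0to-cong n paired ⟩
        sum0to n (λ i → Z₂ * summand A₁ B₁ i - Z₁ * summand A₂ B₂ i - z * summand A₃ B₃ i + summand e (λ _ → + 0) i)
          ≈⟨ sum0to-linear n Z₂ Z₁ z _ _ _ _ ⟩
        Z₂ * sum0to n (summand A₁ B₁) - Z₁ * sum0to n (summand A₂ B₂) - z * sum0to n (summand A₃ B₃)
          + sum0to n (summand e (λ _ → + 0)) ∎
        where
        S Z₁ Z₂ : Carrier
        S  = sumUpTo k (λ j → (f * x ^ᶻ (r ℤ.* j ℤ.+ s) + g * y ^ᶻ (r ℤ.* j ℤ.+ s)) ^ n * z ^ᶻ j)
        Z₁ = z ^ᶻ (k ℤ.+ + 1)
        Z₂ = z ^ᶻ (k ℤ.+ + 2)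
        paired : ∀ i → i ℕ.≤ n →
          Mirror.coefficient i * Mirror.series i + coefficient i * series i
            ≈ Z₂ * summand A₁ B₁ i - Z₁ * summand A₂ B₂ i - z * summand A₃ B₃ i + summand e (λ _ → + 0) i
        paired i i≤n = begin
          Mirror.coefficient i * Mirror.series i + coefficient i * series i
            ≈⟨ +-cong (Mirror.coefficient*series i (λ D′≈0 → D≉0 i i≤n (trans (sym (D-mirror i)) D′≈0)))
                      (coefficient*series i (D≉0 i i≤n)) ⟩
          (Z₂ * p₁′ - Z₁ * p₂′ - z * p₃′ + p₄′) + (Z₂ * p₁ - Z₁ * p₂ - z * p₃ + p₄)
            ≈⟨ solve 11 (λ Z₂ Z₁ z p₁′ p₂′ p₃′ p₄′ p₁ p₂ p₃ p₄ →
                 (Z₂ :* p₁′ :- Z₁ :* p₂′ :- z :* p₃′ :+ p₄′) :+ (Z₂ :* p₁ :- Z₁ :* p₂ :- z :* p₃ :+ p₄)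
                 := Z₂ :* (p₁′ :+ p₁) :- Z₁ :* (p₂′ :+ p₂) :- z :* (p₃′ :+ p₃) :+ (p₄′ :+ p₄))
               refl Z₂ Z₁ z p₁′ p₂′ p₃′ p₄′ p₁ p₂ p₃ p₄ ⟩
          Z₂ * (p₁′ + p₁) - Z₁ * (p₂′ + p₂) - z * (p₃′ + p₃) + (p₄′ + p₄)
            ≈⟨ +-cong (+-cong (+-cong (*-congˡ (half-summand-pair A₁ B₁ i)) (-‿cong (*-congˡ (half-summand-pair A₂ B₂ i))))
                              (-‿cong (*-congˡ (half-summand-pair A₃ B₃ i))))
                      (half-summand-pair e (λ _ → + 0) i) ⟩
          Z₂ * summand A₁ B₁ i - Z₁ * summand A₂ B₂ i - z * summand A₃ B₃ i + summand e (λ _ → + 0) i ∎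
          where
          p₁′ p₂′ p₃′ p₄′ p₁ p₂ p₃ p₄ : Carrier
          p₁′ = Mirror.half-summand A₁ B₁ i
          p₂′ = Mirror.half-summand A₂ B₂ i
          p₃′ = Mirror.half-summand A₃ B₃ i
          p₄′ = Mirror.half-summand e (λ _ → + 0) i
          p₁  = half-summand A₁ B₁ i
          p₂  = half-summand A₂ B₂ i
          p₃  = half-summand A₃ B₃ i
          p₄  = half-summand e (λ _ → + 0) i

lemma2 : ∀ {c ℓ : Level} (F : Field c ℓ) → let open Field F in
         (f g x y z : Carrier) (k r s : ℤ) (n : ℕ) →
         ¬ (x ≈ 0#) → ¬ (y ≈ 0#) →
         -- z^(k+2), z^j etc. with negative exponents only make sense for z ≠ 0
         (k ℤ.< -[1+ 0 ] → ¬ (z ≈ 0#)) →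
         let N : ℤ
             N = + n
             -- D_i = (xy)^{rn} z^2 - (xy)^{ri} (x^{r(n-2i)} + y^{r(n-2i)}) z + 1
             D : ℕ → Carrier
             D i = (x * y) ^ᶻ (r ℤ.* N) * (z ^ 2)
                   - (x * y) ^ᶻ (r ℤ.* (+ i))
                     * (x ^ᶻ (r ℤ.* (N ℤ.- + 2 ℤ.* + i)) + y ^ᶻ (r ℤ.* (N ℤ.- + 2 ℤ.* + i))) * z
                   + 1#
             -- Σ_{i=0}^n (fg)^i (xy)^{si} (n choose i)
             --    (f^{n-2i} x^{a i} y^{b i} + g^{n-2i} x^{b i} y^{a i}) / D_i
             -- with (fg)^i f^{n-2i} := f^{n-i} g^i and (fg)^i g^{n-2i} := f^i g^{n-i}
             T : (ℕ → ℤ) → (ℕ → ℤ) → Carrier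
             T a b = sum0to n (λ i →
                       (x * y) ^ᶻ (s ℤ.* (+ i)) * fromℕ (n C i)
                       * ((f ^ (n ∸ i) * g ^ i * x ^ᶻ a i * y ^ᶻ b i
                           + f ^ i * g ^ (n ∸ i) * x ^ᶻ b i * y ^ᶻ a i) / D i))
             -- s(n - 2i)
             e : ℕ → ℤ
             e i = s ℤ.* (N ℤ.- + 2 ℤ.* + i)
             k1 : ℤ
             k1 = k ℤ.+ + 1
         in
         (∀ i → i ℕ.≤ n → ¬ (D i ≈ 0#)) →
         (1# + 1#) * sumUpTo k (λ j → (f * x ^ᶻ (r ℤ.* j ℤ.+ s) + g * y ^ᶻ (r ℤ.* j ℤ.+ s)) ^ n * z ^ᶻ j)
         ≈ z ^ᶻ (k ℤ.+ + 2)
             * T (λ i → e i ℤ.+ r ℤ.* N ℤ.* k1 ℤ.- r ℤ.* (+ i) ℤ.* k)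
                 (λ i → r ℤ.* ((+ i) ℤ.* k ℤ.+ N))
           - z ^ᶻ k1
             * T (λ i → e i ℤ.+ (r ℤ.* N ℤ.- r ℤ.* (+ i)) ℤ.* k1)
                 (λ i → r ℤ.* (+ i) ℤ.* k1)
           - z * T (λ i → e i ℤ.+ r ℤ.* (+ i)) (λ i → r ℤ.* (N ℤ.- + i))
           + T e (λ i → + 0)
lemma2 F f g x y z k r s n x≉0 y≉0 hz D≉0 =
  FieldProperties.PowerSum.power-sum-closed-form F z k r s n hz f g x y x≉0 y≉0 D≉0
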